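{- Let $p\ge 3$ and $n\ge 2$. Let $H_1,H_2$ be the subgraphs of $H_p^n$ induced by the configurations whose largest disc $d_n$ lies on peg $1$, respectively peg $2$ (each isomorphic to $H_p^{n-1}$). Suppose there exists a uniform multicommodity flow in $H_p^{n-1}$ with congestion $\rho$. Then for each $s\in V(H_1)$ the MSF problem $\pi_{shuf}(s)=(\{s\},V(H_1),\sigma\equiv|V(H_2)|,\delta\equiv 1)$ can be solved by an MSF $f_{shuf}^{s}$ in $H_p^n$ such that the sum $\sum_{s\in V(H_1)}f_{shuf}^{s}$ has congestion at most $\rho\cdot\frac{|V(H_1)|}{|V(H_p^n)|}$, where the congestion of a function $g\colon A\to\mathbb{R}_{\ge0}$ on the arcs of $H_p^n$ means $\frac{1}{|V(H_p^n)|}\max_{a\in A}g(a)$.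
   Context: The Tower of Hanoi puzzle has $n$ discs $d_1,\dots,d_n$ ($d_i$ larger than $d_j$ when $i>j$) and pegs $[p]$; configurations are functions $\tau\colon\{d_1,\dots,d_n\}\to[p]$, and $H_p^n$ has the configurations as vertices, two being adjacent iff they differ by a single legal move (moving a top disc onto a peg whose discs are all larger). For a graph $G=(V,E)$, $A$ denotes the set of arcs $(u,v),(v,u)$ for each edge $\{u,v\}\in E$, and $N(v)$ the neighbourhood of $v$. A uniform multicommodity flow is a family $f_{st}\colon A\to\mathbb{R}_{\ge0}$, $(s,t)\in V\times V$, each sending one unit from $s$ to $t$ with flow conservation at other vertices; its congestion is $\frac{1}{|V|}\max_{a\in A}\sum_{(s,t)}f_{st}(a)$. An MSF problem is a tuple $(S,T,\sigma,\delta)$ with $S,T\subseteq V$, $\sigma\colon S\to\mathbb{R}$, $\delta\colon T\to\mathbb{R}$; an MSF solving it is $f\colon A\to\mathbb{R}_{\ge0}$ such that, writing $\mathrm{net}(u)=\sum_{v\in N(u)}(f(u,v)-f(v,u))$: $\mathrm{net}(u)=\sigma(u)$ for $u\in S\setminus T$; $-\mathrm{net}(u)=\delta(u)$ for $u\in T\setminus S$; $\mathrm{net}(u)=\sigma(u)-\delta(u)$ for $u\in S\cap T$; and $\mathrm{net}(u)=0$ for $u\notin S\cup T$.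
   Formalization: The uniform multicommodity flow in $H_p^{n-1}$ and its congestion ρ take rational values rather than real ones, and the MSFs $f_{shuf}^{s}$ are taken in ℚ. -}

module Defs where

open import Data.Bool using (Bool; true; false; _∧_; not; if_then_else_)
open import Data.Nat as ℕ using (ℕ; zero; suc; _≡ᵇ_)
open import Data.Integer using (+_)
open import Data.Fin as Fin using (Fin; toℕ)
open import Data.Vec using (Vec; []; _∷_; lookup)
open import Data.Vec.Properties using (≡-dec)
open import Data.List using (filterᵇ; List; []; _∷_; [_]; map; concatMap; foldr; allFin; length)
open import Data.Bool.ListAction using (any; all)
open import Data.Rational using (ℚ; 0ℚ; 1ℚ; _+_; _-_; _*_; _/_; _≤_; -_)
open import Data.Product using (Σ; _×_; _,_; ∃)
open import Relation.Nullary.Decidable using (⌊_⌋)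
open import Relation.Binary.PropositionalEquality using (_≡_)

-- Configurations of n discs on p pegs (pegs 1..p are Fin p elements 0..p-1).
-- Position i of the vector holds the peg of a disc; position 0 is the LARGEST
-- disc d_n, and position i holds disc d_{n-i}; so the disc at position j is
-- smaller than the disc at position i iff toℕ i < toℕ j.
Config : ℕ → ℕ → Set
Config p n = Vec (Fin p) n

allConfigs : (p n : ℕ) → List (Config p n)
allConfigs p zero = [ [] ]
allConfigs p (suc n) = concatMap (λ x → map (x ∷_) (allConfigs p n)) (allFin p)

_==_ : {p n : ℕ} → Config p n → Config p n → Bool
u == v = ⌊ ≡-dec Fin._≟_ u v ⌋

_≠ᶠ_ : {p : ℕ} → Fin p → Fin p → Bool
a ≠ᶠ b = not ⌊ a Fin.≟ b ⌋

-- The move of the disc at position i takes u to v legally: the disc changes peg,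
-- every other disc stays, and no smaller disc lies on the source peg (disc is on
-- top) nor on the target peg (all discs there are larger).
legalMoveOf : {p n : ℕ} → Config p n → Config p n → Fin n → Bool
legalMoveOf {n = n} u v i =
  (lookup u i ≠ᶠ lookup v i)
  ∧ all (λ j → ⌊ j Fin.≟ i ⌋ ∨' ⌊ lookup u j Fin.≟ lookup v j ⌋) (allFin n)
  ∧ all (λ j → not ⌊ toℕ i ℕ.<? toℕ j ⌋ ∨' ((lookup u j ≠ᶠ lookup u i) ∧ (lookup u j ≠ᶠ lookup v i))) (allFin n)
  where
  _∨'_ : Bool → Bool → Bool
  true ∨' _ = true
  false ∨' b = b

adj : {p n : ℕ} → Config p n → Config p n → Bool
adj {n = n} u v = any (legalMoveOf u v) (allFin n)

IsArc : {p n : ℕ} → Config p n → Config p n → Set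
IsArc u v = adj u v ≡ true

sumOver : {A : Set} → List A → (A → ℚ) → ℚ
sumOver xs f = foldr (λ x r → f x + r) 0ℚ xs

-- Natural numbers as rationals, and 1/k (with 1/0 := 0, never used here since |V|>0).
ℕ→ℚ : ℕ → ℚ
ℕ→ℚ k = (+ k) / 1

inv : ℕ → ℚ
inv zero = 0ℚ
inv (suc k) = (+ 1) / suc k

numV : (p n : ℕ) → ℕ
numV p n = length (allConfigs p n)

-- Arc functions A → ℚ are represented as functions on ordered pairs of
-- configurations; only their values on arcs are ever used.
ArcFun : ℕ → ℕ → Set
ArcFun p n = Config p n → Config p n → ℚ

net : {p n : ℕ} → ArcFun p n → Config p n → ℚ
net {p} {n} f u = sumOver (allConfigs p n) (λ v → if adj u v then f u v - f v u else 0ℚ)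

-- Required net value at u for the MSF problem (S, T, σ, δ), with S and T given
-- by their (Boolean) membership predicates at u.
required : Bool → Bool → ℚ → ℚ → ℚ
required true  false σu δu = σu
required false true  σu δu = - δu
required true  true  σu δu = σu - δu
required false false σu δu = 0ℚ

SolvesMSF : {p n : ℕ} → (S T : Config p n → Bool) → (σ δ : Config p n → ℚ) → ArcFun p n → Set
SolvesMSF S T σ δ f =
  (∀ u v → IsArc u v → 0ℚ ≤ f u v) ×
  (∀ u → net f u ≡ required (S u) (T u) (σ u) (δ u))

CongestionAtMost : (p n : ℕ) → ArcFun p n → ℚ → Set
CongestionAtMost p n g c = ∀ u v → IsArc u v → inv (numV p n) * g u v ≤ c

CongestionIs : (p n : ℕ) → ArcFun p n → ℚ → Set
CongestionIs p n g c =
  CongestionAtMost p n g c ×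
  Σ (Config p n) (λ u → Σ (Config p n) (λ v → IsArc u v × (inv (numV p n) * g u v ≡ c)))

UniformMCF : (p n : ℕ) → Set
UniformMCF p n = Config p n → Config p n → ArcFun p n

IsUniformMCF : (p n : ℕ) → UniformMCF p n → Set
IsUniformMCF p n f = ∀ s t → SolvesMSF (λ u → u == s) (λ u → u == t) (λ _ → 1ℚ) (λ _ → 1ℚ) (f s t)

mcfLoad : (p n : ℕ) → UniformMCF p n → ArcFun p n
mcfLoad p n f u v = sumOver (allConfigs p n) (λ s → sumOver (allConfigs p n) (λ t → f s t u v))

HasUniformMCFWithCongestion : (p n : ℕ) → ℚ → Set
HasUniformMCFWithCongestion p n ρ =
  Σ (UniformMCF p n) (λ f → IsUniformMCF p n f × CongestionIs p n (mcfLoad p n f) ρ)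

-- Configurations whose largest disc (position 0) lies on peg k+1 (Fin index k).
largestOn : {p n : ℕ} → ℕ → Config p n → Bool
largestOn k [] = false
largestOn k (x ∷ _) = toℕ x ≡ᵇ k

inH1 inH2 : {p n : ℕ} → Config p n → Bool
inH1 = largestOn 0
inH2 = largestOn 1

VH1 VH2 : (p n : ℕ) → List (Config p n)
VH1 p n = filterᵇ inH1 (allConfigs p n)
VH2 p n = filterᵇ inH2 (allConfigs p n)

{-# OPTIONS --safe #-}
-- Fixing the largest disc on peg 1 embeds H_p^{n-1} as H₁, since the legality of a move of a
-- smaller disc does not depend on it.  Summing the commodities (s , t) of the uniform flow over
-- all targets t therefore gives a flow in H₁ that sends |V(H₁)| = |V(H₂)| units out of s and
-- delivers one unit to each vertex of H₁: it solves π_shuf(s).  Summed over the sources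
-- s ∈ V(H₁) these flows reproduce the load of the uniform flow on the arcs of H₁ and vanish
-- elsewhere, so only the normalisation changes, from 1/|V(H₁)| to 1/|V(H_p^n)|.
module Submission where

open import Defs
open import Algebra.Bundles using (CommutativeMonoid)
import Algebra.Properties.CommutativeSemigroup as CommSemigroupProperties
open import Data.Bool using (Bool; true; false; _∧_; _∨_; not; if_then_else_)
open import Data.Bool.ListAction using (and; or; all; any)
open import Data.Bool.Properties using (if-eta; if-∧)
open import Data.Fin using (Fin; zero; suc; toℕ; _≟_)
open import Data.List using (List; []; _∷_; _++_; map; allFin; concatMap; filterᵇ; length)
open import Data.List.Properties using (map-cong; map-tabulate; length-map; length-++-≤ˡ)
open import Data.Nat as ℕ using (ℕ; zero; suc; _≡ᵇ_; NonZero; >-nonZero; z≤n; s≤s)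
import Data.Nat.Properties as ℕ
import Data.Nat.Coprimality as Coprimality
import Data.Integer as ℤ
import Data.Integer.Properties as ℤ
open import Data.Product using (Σ; _×_; _,_; proj₁; proj₂)
open import Data.Rational
  using (ℚ; 0ℚ; 1ℚ; _+_; _-_; -_; _*_; _/_; _≤_; mkℚ; NonNegative; nonNegative)
open import Data.Rational.Properties
  using ( +-identityˡ; +-identityʳ; +-assoc; neg-distrib-+; +-mono-≤; ≤-refl; *-comm
        ; *-identityˡ; *-zeroʳ; *-inverseʳ; *-monoˡ-≤-nonNeg; ↥p/↧p≡p; normalize-nonNeg
        ; nonNegative⁻¹; nonNeg*nonNeg⇒nonNeg; +-0-commutativeMonoid; *-1-commutativeMonoid
        ; module ≤-Reasoning )
open import Data.Vec using ([]; _∷_; lookup)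
open import Data.Vec.Properties using (≡-dec)
open import Function using (id; _∘_)
open import Relation.Binary.PropositionalEquality
open import Relation.Nullary.Decidable using (Dec; does; ⌊_⌋; isYes≗does; dec-true)

open CommSemigroupProperties (CommutativeMonoid.commutativeSemigroup +-0-commutativeMonoid)
  using () renaming (interchange to +-interchange)
open CommSemigroupProperties (CommutativeMonoid.commutativeSemigroup *-1-commutativeMonoid)
  using () renaming (interchange to *-interchange)

isYes-cong : ∀ {a b} {A : Set a} {B : Set b} (a? : Dec A) (b? : Dec B) →
  does a? ≡ does b? → ⌊ a? ⌋ ≡ ⌊ b? ⌋
isYes-cong a? b? eq = trans (isYes≗does a?) (trans eq (sym (isYes≗does b?)))

≟-refl : ∀ {k} (x : Fin k) → ⌊ x ≟ x ⌋ ≡ true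
≟-refl x = trans (isYes≗does (x ≟ x)) (dec-true (x ≟ x) refl)

suc-≟-suc : ∀ {k} (x y : Fin k) → ⌊ suc x ≟ suc y ⌋ ≡ ⌊ x ≟ y ⌋
suc-≟-suc x y = isYes-cong (suc x ≟ suc y) (x ≟ y) refl

suc-<?-suc : ∀ (m n : ℕ) → ⌊ suc m ℕ.<? suc n ⌋ ≡ ⌊ m ℕ.<? n ⌋
suc-<?-suc m n = isYes-cong (suc m ℕ.<? suc n) (m ℕ.<? n) refl

toℕ-≡ᵇ : ∀ {k} (x y : Fin k) → (toℕ y ≡ᵇ toℕ x) ≡ ⌊ x ≟ y ⌋
toℕ-≡ᵇ zero    zero    = refl
toℕ-≡ᵇ zero    (suc y) = refl
toℕ-≡ᵇ (suc x) zero    = refl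
toℕ-≡ᵇ (suc x) (suc y) = trans (toℕ-≡ᵇ x y) (sym (suc-≟-suc x y))

==-∷ : ∀ {p n} (x y : Fin p) (u v : Config p n) →
  ((x ∷ u) == (y ∷ v)) ≡ ⌊ x ≟ y ⌋ ∧ (u == v)
==-∷ x y u v = trans (isYes≗does _)
  (sym (cong₂ _∧_ (isYes≗does (x ≟ y)) (isYes≗does (≡-dec _≟_ u v))))

sumOver-cong : ∀ {A : Set} (xs : List A) {g h : A → ℚ} →
  (∀ x → g x ≡ h x) → sumOver xs g ≡ sumOver xs h
sumOver-cong []       g≗h = refl
sumOver-cong (x ∷ xs) g≗h = cong₂ _+_ (g≗h x) (sumOver-cong xs g≗h)

sumOver-zero : ∀ {A : Set} (xs : List A) {g : A → ℚ} →
  (∀ x → g x ≡ 0ℚ) → sumOver xs g ≡ 0ℚ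
sumOver-zero []       g≗0 = refl
sumOver-zero (x ∷ xs) g≗0 =
  trans (cong₂ _+_ (g≗0 x) (sumOver-zero xs g≗0)) (+-identityˡ 0ℚ)

sumOver-++ : ∀ {A : Set} (xs ys : List A) (g : A → ℚ) →
  sumOver (xs ++ ys) g ≡ sumOver xs g + sumOver ys g
sumOver-++ []       ys g = sym (+-identityˡ _)
sumOver-++ (x ∷ xs) ys g = trans (cong (g x +_) (sumOver-++ xs ys g)) (sym (+-assoc (g x) _ _))

sumOver-map : ∀ {A B : Set} (h : A → B) (xs : List A) (g : B → ℚ) →
  sumOver (map h xs) g ≡ sumOver xs (g ∘ h)
sumOver-map h []       g = refl
sumOver-map h (x ∷ xs) g = cong (g (h x) +_) (sumOver-map h xs g)

sumOver-concatMap : ∀ {A B : Set} (h : A → List B) (xs : List A) (g : B → ℚ) →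
  sumOver (concatMap h xs) g ≡ sumOver xs (λ x → sumOver (h x) g)
sumOver-concatMap h []       g = refl
sumOver-concatMap h (x ∷ xs) g =
  trans (sumOver-++ (h x) _ g) (cong (sumOver (h x) g +_) (sumOver-concatMap h xs g))

sumOver-+ : ∀ {A : Set} (xs : List A) (g h : A → ℚ) →
  sumOver xs (λ x → g x + h x) ≡ sumOver xs g + sumOver xs h
sumOver-+ []       g h = refl
sumOver-+ (x ∷ xs) g h =
  trans (cong (g x + h x +_) (sumOver-+ xs g h)) (+-interchange (g x) (h x) _ _)

sumOver-sub : ∀ {A : Set} (xs : List A) (g h : A → ℚ) →
  sumOver xs (λ x → g x - h x) ≡ sumOver xs g - sumOver xs h
sumOver-sub []       g h = refl
sumOver-sub (x ∷ xs) g h = begin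
  (g x - h x) + sumOver xs (λ x → g x - h x)
    ≡⟨ cong ((g x - h x) +_) (sumOver-sub xs g h) ⟩
  (g x - h x) + (sumOver xs g - sumOver xs h)
    ≡⟨ +-interchange (g x) (- h x) _ _ ⟩
  (g x + sumOver xs g) + (- h x + - sumOver xs h)
    ≡⟨ cong (g x + sumOver xs g +_) (sym (neg-distrib-+ (h x) (sumOver xs h))) ⟩
  (g x + sumOver xs g) - (h x + sumOver xs h) ∎
  where open ≡-Reasoning

sumOver-swap : ∀ {A B : Set} (xs : List A) (ys : List B) (k : A → B → ℚ) →
  sumOver xs (λ x → sumOver ys (k x)) ≡ sumOver ys (λ y → sumOver xs (λ x → k x y))
sumOver-swap []       ys k = sym (sumOver-zero ys (λ _ → refl))
sumOver-swap (x ∷ xs) ys k =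
  trans (cong (sumOver ys (k x) +_) (sumOver-swap xs ys k)) (sym (sumOver-+ ys (k x) _))

sumOver-if : ∀ {A : Set} b (xs : List A) (g : A → ℚ) →
  sumOver xs (λ x → if b then g x else 0ℚ) ≡ (if b then sumOver xs g else 0ℚ)
sumOver-if true  xs g = refl
sumOver-if false xs g = sumOver-zero xs (λ _ → refl)

sumOver-filterᵇ : ∀ {A : Set} (P : A → Bool) (xs : List A) (g : A → ℚ) →
  sumOver (filterᵇ P xs) g ≡ sumOver xs (λ x → if P x then g x else 0ℚ)
sumOver-filterᵇ P []       g = refl
sumOver-filterᵇ P (x ∷ xs) g with P x
... | true  = cong (g x +_) (sumOver-filterᵇ P xs g)
... | false = trans (sumOver-filterᵇ P xs g) (sym (+-identityˡ _))

sumOver-nonNeg : ∀ {A : Set} (xs : List A) {g : A → ℚ} →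
  (∀ x → 0ℚ ≤ g x) → 0ℚ ≤ sumOver xs g
sumOver-nonNeg []       g≥0 = ≤-refl
sumOver-nonNeg (x ∷ xs) g≥0 = +-mono-≤ (g≥0 x) (sumOver-nonNeg xs g≥0)

ℕ→ℚ≡mkℚ : ∀ k → ℕ→ℚ k ≡ mkℚ (ℤ.+ k) 0 (Coprimality.sym (Coprimality.1-coprimeTo k))
ℕ→ℚ≡mkℚ k = ↥p/↧p≡p (mkℚ (ℤ.+ k) 0 _)

inv≡mkℚ : ∀ k → inv (suc k) ≡ mkℚ (ℤ.+ 1) k (Coprimality.1-coprimeTo (suc k))
inv≡mkℚ k = ↥p/↧p≡p (mkℚ (ℤ.+ 1) k _)

-- 1ℚ + mkℚ (+ k) 0 _ computes to (+ 1 ℤ.+ + k ℤ.* + 1) / 1.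
ℕ→ℚ-suc : ∀ k → ℕ→ℚ (suc k) ≡ 1ℚ + ℕ→ℚ k
ℕ→ℚ-suc k = trans (cong (λ z → (ℤ.+ 1 ℤ.+ z) / 1) (sym (ℤ.*-identityʳ (ℤ.+ k))))
                  (cong (1ℚ +_) (sym (ℕ→ℚ≡mkℚ k)))

ℕ→ℚ*inv : ∀ n .{{_ : NonZero n}} → ℕ→ℚ n * inv n ≡ 1ℚ
ℕ→ℚ*inv (suc k) = trans (cong₂ _*_ (ℕ→ℚ≡mkℚ (suc k)) (inv≡mkℚ k))
  (*-inverseʳ (mkℚ (ℤ.+ suc k) 0 (Coprimality.sym (Coprimality.1-coprimeTo (suc k)))))

ℕ→ℚ-nonNeg : ∀ k → NonNegative (ℕ→ℚ k)
ℕ→ℚ-nonNeg k = normalize-nonNeg k 1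

inv-nonNeg : ∀ k → NonNegative (inv k)
inv-nonNeg zero    = _
inv-nonNeg (suc k) = normalize-nonNeg 1 (suc k)

ℕ→ℚ*inv-nonNeg : ∀ N M → NonNegative (ℕ→ℚ N * inv M)
ℕ→ℚ*inv-nonNeg N M = nonNeg*nonNeg⇒nonNeg (ℕ→ℚ N) {{ℕ→ℚ-nonNeg N}} (inv M) {{inv-nonNeg M}}

ℕ→ℚ-length : ∀ {A : Set} (xs : List A) → ℕ→ℚ (length xs) ≡ sumOver xs (λ _ → 1ℚ)
ℕ→ℚ-length []       = refl
ℕ→ℚ-length (x ∷ xs) = trans (ℕ→ℚ-suc (length xs)) (cong (1ℚ +_) (ℕ→ℚ-length xs))

*-nonNeg : ∀ {a b} → 0ℚ ≤ a → 0ℚ ≤ b → 0ℚ ≤ a * b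
*-nonNeg {a} {b} a≥0 b≥0 =
  nonNegative⁻¹ (a * b) {{nonNeg*nonNeg⇒nonNeg a {{nonNegative a≥0}} b {{nonNegative b≥0}}}}

map-allFin-suc : ∀ {A : Set} {k} (f : Fin (suc k) → A) →
  map f (allFin (suc k)) ≡ f zero ∷ map (f ∘ suc) (allFin k)
map-allFin-suc f = trans (map-tabulate id f) (cong (f zero ∷_) (sym (map-tabulate id (f ∘ suc))))

all-allFin-suc : ∀ {k} (f : Fin (suc k) → Bool) (g : Fin k → Bool) →
  f zero ≡ true → (∀ j → f (suc j) ≡ g j) → all f (allFin (suc k)) ≡ all g (allFin k)
all-allFin-suc {k} f g f0 fs =
  trans (cong and (map-allFin-suc f)) (cong₂ _∧_ f0 (cong and (map-cong fs (allFin k))))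

any-allFin-suc : ∀ {k} (f : Fin (suc k) → Bool) (g : Fin k → Bool) →
  f zero ≡ false → (∀ j → f (suc j) ≡ g j) → any f (allFin (suc k)) ≡ any g (allFin k)
any-allFin-suc {k} f g f0 fs =
  trans (cong or (map-allFin-suc f)) (cong₂ _∨_ f0 (cong or (map-cong fs (allFin k))))

sumOver-allFin-suc : ∀ {k} (g : Fin (suc k) → ℚ) →
  sumOver (allFin (suc k)) g ≡ g zero + sumOver (allFin k) (g ∘ suc)
sumOver-allFin-suc {k} g = cong (g zero +_)
  (trans (cong (λ xs → sumOver xs g) (sym (map-tabulate id suc))) (sumOver-map suc (allFin k) g))

sumOver-allFin-≟ : ∀ {k} (x : Fin k) (g : Fin k → ℚ) →
  sumOver (allFin k) (λ y → if ⌊ x ≟ y ⌋ then g y else 0ℚ) ≡ g x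
sumOver-allFin-≟ {suc k} zero g = begin
  sumOver (allFin (suc k)) (λ y → if ⌊ zero ≟ y ⌋ then g y else 0ℚ)
    ≡⟨ sumOver-allFin-suc (λ y → if ⌊ zero ≟ y ⌋ then g y else 0ℚ) ⟩
  g zero + sumOver (allFin k) (λ _ → 0ℚ)
    ≡⟨ cong (g zero +_) (sumOver-zero (allFin k) (λ _ → refl)) ⟩
  g zero + 0ℚ
    ≡⟨ +-identityʳ (g zero) ⟩
  g zero ∎
  where open ≡-Reasoning
sumOver-allFin-≟ {suc k} (suc x) g = begin
  sumOver (allFin (suc k)) (λ y → if ⌊ suc x ≟ y ⌋ then g y else 0ℚ)
    ≡⟨ trans (sumOver-allFin-suc (λ y → if ⌊ suc x ≟ y ⌋ then g y else 0ℚ))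
             (+-identityˡ _) ⟩
  sumOver (allFin k) (λ y → if ⌊ suc x ≟ suc y ⌋ then g (suc y) else 0ℚ)
    ≡⟨ sumOver-cong (allFin k) (λ y →
         cong (λ b → if b then g (suc y) else 0ℚ) (suc-≟-suc x y)) ⟩
  sumOver (allFin k) (λ y → if ⌊ x ≟ y ⌋ then g (suc y) else 0ℚ)
    ≡⟨ sumOver-allFin-≟ x (g ∘ suc) ⟩
  g (suc x) ∎
  where open ≡-Reasoning

sumOver-allConfigs-suc : ∀ {p m} (g : Config p (suc m) → ℚ) →
  sumOver (allConfigs p (suc m)) g ≡
  sumOver (allFin p) (λ x → sumOver (allConfigs p m) (g ∘ (x ∷_)))
sumOver-allConfigs-suc {p} {m} g =
  trans (sumOver-concatMap (λ x → map (x ∷_) (allConfigs p m)) (allFin p) g)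
        (sumOver-cong (allFin p) (λ x → sumOver-map (x ∷_) (allConfigs p m) g))

sumOver-allConfigs-peg₀ : ∀ {q m} (g : Config (suc q) (suc m) → ℚ) →
  (∀ x v → g (suc x ∷ v) ≡ 0ℚ) →
  sumOver (allConfigs (suc q) (suc m)) g ≡ sumOver (allConfigs (suc q) m) (g ∘ (zero ∷_))
sumOver-allConfigs-peg₀ {q} {m} g g≡0 = begin
  sumOver (allConfigs (suc q) (suc m)) g
    ≡⟨ sumOver-allConfigs-suc g ⟩
  sumOver (allFin (suc q)) (λ x → sumOver C (g ∘ (x ∷_)))
    ≡⟨ sumOver-allFin-suc (λ x → sumOver C (g ∘ (x ∷_))) ⟩
  sumOver C (g ∘ (zero ∷_)) + sumOver (allFin q) (λ x → sumOver C (g ∘ (suc x ∷_)))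
    ≡⟨ cong (sumOver C (g ∘ (zero ∷_)) +_)
            (sumOver-zero (allFin q) (λ x → sumOver-zero C (g≡0 x))) ⟩
  sumOver C (g ∘ (zero ∷_)) + 0ℚ
    ≡⟨ +-identityʳ _ ⟩
  sumOver C (g ∘ (zero ∷_)) ∎
  where
  open ≡-Reasoning
  C : List (Config (suc q) m)
  C = allConfigs (suc q) m

sumOver-allConfigs-== : ∀ {p m} (u : Config p m) (g : Config p m → ℚ) →
  sumOver (allConfigs p m) (λ t → if u == t then g t else 0ℚ) ≡ g u
sumOver-allConfigs-== []      g = +-identityʳ (g [])
sumOver-allConfigs-== {p} {suc m} (y ∷ u) g = begin
  sumOver (allConfigs p (suc m)) (λ t → if (y ∷ u) == t then g t else 0ℚ)
    ≡⟨ sumOver-allConfigs-suc (λ t → if (y ∷ u) == t then g t else 0ℚ) ⟩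
  sumOver (allFin p) (λ x → sumOver C (λ v → if (y ∷ u) == (x ∷ v) then g (x ∷ v) else 0ℚ))
    ≡⟨ sumOver-cong (allFin p) headFirst ⟩
  sumOver (allFin p) (λ x →
    if ⌊ y ≟ x ⌋ then sumOver C (λ v → if u == v then g (x ∷ v) else 0ℚ) else 0ℚ)
    ≡⟨ sumOver-cong (allFin p) (λ x →
         cong (λ s → if ⌊ y ≟ x ⌋ then s else 0ℚ) (sumOver-allConfigs-== u (g ∘ (x ∷_)))) ⟩
  sumOver (allFin p) (λ x → if ⌊ y ≟ x ⌋ then g (x ∷ u) else 0ℚ)
    ≡⟨ sumOver-allFin-≟ y (λ x → g (x ∷ u)) ⟩
  g (y ∷ u) ∎
  where
  open ≡-Reasoning
  C : List (Config p m)
  C = allConfigs p m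
  headFirst : ∀ x →
    sumOver C (λ v → if (y ∷ u) == (x ∷ v) then g (x ∷ v) else 0ℚ) ≡
    (if ⌊ y ≟ x ⌋ then sumOver C (λ v → if u == v then g (x ∷ v) else 0ℚ) else 0ℚ)
  headFirst x = trans
    (sumOver-cong C (λ v → trans (cong (λ b → if b then g (x ∷ v) else 0ℚ) (==-∷ y x u v))
                                 (if-∧ ⌊ y ≟ x ⌋)))
    (sumOver-if ⌊ y ≟ x ⌋ C (λ v → if u == v then g (x ∷ v) else 0ℚ))

sumOver-largestOn : ∀ {p m} (x : Fin p) (g : Config p (suc m) → ℚ) →
  sumOver (filterᵇ (largestOn (toℕ x)) (allConfigs p (suc m))) g ≡
  sumOver (allConfigs p m) (g ∘ (x ∷_))
sumOver-largestOn {p} {m} x g = begin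
  sumOver (filterᵇ (largestOn (toℕ x)) (allConfigs p (suc m))) g
    ≡⟨ sumOver-filterᵇ (largestOn (toℕ x)) (allConfigs p (suc m)) g ⟩
  sumOver (allConfigs p (suc m)) (λ t → if largestOn (toℕ x) t then g t else 0ℚ)
    ≡⟨ sumOver-allConfigs-suc (λ t → if largestOn (toℕ x) t then g t else 0ℚ) ⟩
  sumOver (allFin p) (λ y → sumOver C (λ v → if toℕ y ≡ᵇ toℕ x then g (y ∷ v) else 0ℚ))
    ≡⟨ sumOver-cong (allFin p) (λ y → trans (sumOver-if (toℕ y ≡ᵇ toℕ x) C (g ∘ (y ∷_)))
         (cong (λ b → if b then sumOver C (g ∘ (y ∷_)) else 0ℚ) (toℕ-≡ᵇ x y))) ⟩
  sumOver (allFin p) (λ y → if ⌊ x ≟ y ⌋ then sumOver C (g ∘ (y ∷_)) else 0ℚ)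
    ≡⟨ sumOver-allFin-≟ x (λ y → sumOver C (g ∘ (y ∷_))) ⟩
  sumOver C (g ∘ (x ∷_)) ∎
  where
  open ≡-Reasoning
  C : List (Config p m)
  C = allConfigs p m

ℕ→ℚ-length-largestOn : ∀ {p m} (x : Fin p) →
  ℕ→ℚ (length (filterᵇ (largestOn (toℕ x)) (allConfigs p (suc m)))) ≡ ℕ→ℚ (numV p m)
ℕ→ℚ-length-largestOn {p} {m} x = begin
  ℕ→ℚ (length (filterᵇ (largestOn (toℕ x)) (allConfigs p (suc m))))
    ≡⟨ ℕ→ℚ-length (filterᵇ (largestOn (toℕ x)) (allConfigs p (suc m))) ⟩
  sumOver (filterᵇ (largestOn (toℕ x)) (allConfigs p (suc m))) (λ _ → 1ℚ)
    ≡⟨ sumOver-largestOn x (λ _ → 1ℚ) ⟩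
  sumOver (allConfigs p m) (λ _ → 1ℚ)
    ≡⟨ sym (ℕ→ℚ-length (allConfigs p m)) ⟩
  ℕ→ℚ (numV p m) ∎
  where open ≡-Reasoning

numV-nonZero : ∀ q m → NonZero (numV (suc q) m)
numV-nonZero q m = >-nonZero (positive m)
  where
  positive : ∀ m → 0 ℕ.< numV (suc q) m
  positive zero    = s≤s z≤n
  positive (suc m) = ℕ.<-≤-trans (positive m)
    (ℕ.≤-trans (ℕ.≤-reflexive (sym (length-map (zero ∷_) (allConfigs (suc q) m))))
               (length-++-≤ˡ (map (zero ∷_) (allConfigs (suc q) m))))

-- Moves within a copy of H_p^m with the largest disc fixed

othersFixed unblocked : ∀ {p n} → Config p n → Config p n → Fin n → Fin n → Bool
othersFixed u v i j = ⌊ j ≟ i ⌋ ∨ ⌊ lookup u j ≟ lookup v j ⌋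
unblocked u v i j =
  not ⌊ toℕ i ℕ.<? toℕ j ⌋ ∨ ((lookup u j ≠ᶠ lookup u i) ∧ (lookup u j ≠ᶠ lookup v i))

legalMove : ∀ {p n} → Config p n → Config p n → Fin n → Bool
legalMove {n = n} u v i =
  (lookup u i ≠ᶠ lookup v i)
  ∧ all (othersFixed u v i) (allFin n)
  ∧ all (unblocked u v i) (allFin n)

-- Defs.legalMoveOf phrases these tests with a disjunction local to its definition, which
-- cannot be named here: unification extracts its two tests, and they agree with ours once
-- the first argument of that disjunction is a constructor.
module _ {p n : ℕ} (u v : Config p n) (i : Fin n) where
  private
    tests : Σ (Fin n → Bool) λ others → Σ (Fin n → Bool) λ smaller →
      legalMoveOf u v i ≡
      (lookup u i ≠ᶠ lookup v i) ∧ all others (allFin n) ∧ all smaller (allFin n)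
    tests = _ , _ , refl

    others-spec : ∀ j → proj₁ tests j ≡ othersFixed u v i j
    others-spec j with ⌊ j ≟ i ⌋
    ... | true  = refl
    ... | false = refl

    smaller-spec : ∀ j → proj₁ (proj₂ tests) j ≡ unblocked u v i j
    smaller-spec j with not ⌊ toℕ i ℕ.<? toℕ j ⌋
    ... | true  = refl
    ... | false = refl

  legalMoveOf≡legalMove : legalMoveOf u v i ≡ legalMove u v i
  legalMoveOf≡legalMove = trans (proj₂ (proj₂ tests))
    (cong₂ (λ a b → (lookup u i ≠ᶠ lookup v i) ∧ a ∧ b)
           (cong and (map-cong others-spec (allFin n)))
           (cong and (map-cong smaller-spec (allFin n))))

adj≡anyLegalMove : ∀ {p n} (u v : Config p n) → adj u v ≡ any (legalMove u v) (allFin n)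
adj≡anyLegalMove {n = n} u v = cong or (map-cong (legalMoveOf≡legalMove u v) (allFin n))

module _ {p n : ℕ} (x : Fin p) (u v : Config p n) where

  legalMove-∷-zero : legalMove (x ∷ u) (x ∷ v) zero ≡ false
  legalMove-∷-zero = cong (λ b → not b ∧ all (othersFixed (x ∷ u) (x ∷ v) zero) allFin₁
                                       ∧ all (unblocked (x ∷ u) (x ∷ v) zero) allFin₁)
                           (≟-refl x)
    where
    allFin₁ : List (Fin (suc n))
    allFin₁ = allFin (suc n)

  legalMove-∷-suc : ∀ i → legalMove (x ∷ u) (x ∷ v) (suc i) ≡ legalMove u v i
  legalMove-∷-suc i = cong₂ (λ a b → (lookup u i ≠ᶠ lookup v i) ∧ a ∧ b)
    (all-allFin-suc (othersFixed (x ∷ u) (x ∷ v) (suc i)) (othersFixed u v i)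
       (≟-refl x) (λ j → cong (_∨ ⌊ lookup u j ≟ lookup v j ⌋) (suc-≟-suc j i)))
    (all-allFin-suc (unblocked (x ∷ u) (x ∷ v) (suc i)) (unblocked u v i)
       refl (λ j → cong (λ b → not b ∨ onNeitherPeg j) (suc-<?-suc (toℕ i) (toℕ j))))
    where
    onNeitherPeg : Fin n → Bool
    onNeitherPeg j = (lookup u j ≠ᶠ lookup u i) ∧ (lookup u j ≠ᶠ lookup v i)

  adj-∷ : adj (x ∷ u) (x ∷ v) ≡ adj u v
  adj-∷ = begin
    adj (x ∷ u) (x ∷ v)
      ≡⟨ adj≡anyLegalMove (x ∷ u) (x ∷ v) ⟩
    any (legalMove (x ∷ u) (x ∷ v)) (allFin (suc n))
      ≡⟨ any-allFin-suc (legalMove (x ∷ u) (x ∷ v)) (legalMove u v)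
                        legalMove-∷-zero legalMove-∷-suc ⟩
    any (legalMove u v) (allFin n)
      ≡⟨ sym (adj≡anyLegalMove u v) ⟩
    adj u v ∎
    where open ≡-Reasoning

IsArc-∷ : ∀ {p n} (x : Fin p) (u v : Config p n) → IsArc (x ∷ u) (x ∷ v) → IsArc u v
IsArc-∷ x u v arc = trans (sym (adj-∷ x u v)) arc

netAlong : ∀ {p n} → ArcFun p n → Config p n → Config p n → ℚ
netAlong f u v = if adj u v then f u v - f v u else 0ℚ

net-sumOver : ∀ {p n} {X : Set} (T : List X) (h : X → ArcFun p n) (u : Config p n) →
  net (λ a b → sumOver T (λ t → h t a b)) u ≡ sumOver T (λ t → net (h t) u)
net-sumOver {p} {n} T h u =
  trans (sumOver-cong (allConfigs p n) (λ v → along v (adj u v)))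
        (sumOver-swap (allConfigs p n) T (λ v t → netAlong (h t) u v))
  where
  along : ∀ v b → (if b then sumOver T (λ t → h t u v) - sumOver T (λ t → h t v u) else 0ℚ)
                ≡ sumOver T (λ t → if b then h t u v - h t v u else 0ℚ)
  along v true  = sym (sumOver-sub T (λ t → h t u v) (λ t → h t v u))
  along v false = sym (sumOver-zero T (λ _ → refl))

liftFlow : ∀ {q m} → ArcFun (suc q) m → ArcFun (suc q) (suc m)
liftFlow G (zero  ∷ u) (zero  ∷ v) = G u v
liftFlow G (zero  ∷ u) (suc _ ∷ v) = 0ℚ
liftFlow G (suc _ ∷ u) w           = 0ℚ

liftFlow-into-suc : ∀ {q m} (G : ArcFun (suc q) m) w x u → liftFlow G w (suc x ∷ u) ≡ 0ℚ
liftFlow-into-suc G (zero  ∷ w) x u = refl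
liftFlow-into-suc G (suc _ ∷ w) x u = refl

liftFlow-nonNeg : ∀ {q m} (G : ArcFun (suc q) m) → (∀ u v → IsArc u v → 0ℚ ≤ G u v) →
  ∀ a b → IsArc a b → 0ℚ ≤ liftFlow G a b
liftFlow-nonNeg G G≥0 (zero  ∷ u) (zero  ∷ v) arc = G≥0 u v (IsArc-∷ zero u v arc)
liftFlow-nonNeg G G≥0 (zero  ∷ u) (suc _ ∷ v) _   = ≤-refl
liftFlow-nonNeg G G≥0 (suc _ ∷ u) w           _   = ≤-refl

net-liftFlow-zero : ∀ {q m} (G : ArcFun (suc q) m) u → net (liftFlow G) (zero ∷ u) ≡ net G u
net-liftFlow-zero {q} {m} G u =
  trans (sumOver-allConfigs-peg₀ (netAlong (liftFlow G) (zero ∷ u))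
                                 (λ x v → if-eta (adj (zero ∷ u) (suc x ∷ v))))
        (sumOver-cong (allConfigs (suc q) m)
                      (λ v → cong (λ b → if b then G u v - G v u else 0ℚ) (adj-∷ zero u v)))

net-liftFlow-suc : ∀ {q m} (G : ArcFun (suc q) m) x u → net (liftFlow G) (suc x ∷ u) ≡ 0ℚ
net-liftFlow-suc {q} {m} G x u = sumOver-zero (allConfigs (suc q) (suc m)) (λ w →
  trans (cong (λ y → if adj (suc x ∷ u) w then 0ℚ - y else 0ℚ) (liftFlow-into-suc G w x u))
        (if-eta (adj (suc x ∷ u) w)))

liftFlow-solvesMSF : ∀ {q m} {s : Config (suc q) m} {σ δ : ℚ} {G : ArcFun (suc q) m} →
  SolvesMSF (_== s) (λ _ → true) (λ _ → σ) (λ _ → δ) G →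
  SolvesMSF (_== (zero ∷ s)) inH1 (λ _ → σ) (λ _ → δ) (liftFlow G)
liftFlow-solvesMSF {s = s} {σ} {δ} {G} (G≥0 , netG) = liftFlow-nonNeg G G≥0 , netLifted
  where
  netLifted : ∀ a → net (liftFlow G) a ≡ required (a == (zero ∷ s)) (inH1 a) σ δ
  netLifted (zero ∷ u) = trans (net-liftFlow-zero G u)
    (trans (netG u) (cong (λ b → required b true σ δ) (sym (==-∷ zero zero u s))))
  netLifted (suc x ∷ u) = trans (net-liftFlow-suc G x u)
    (cong (λ b → required b false σ δ) (sym (==-∷ (suc x) zero u s)))

sumOver-liftFlow : ∀ {q m} {X : Set} (T : List X) (h : X → ArcFun (suc q) m) a b →
  sumOver T (λ t → liftFlow (h t) a b) ≡ liftFlow (λ u v → sumOver T (λ t → h t u v)) a b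
sumOver-liftFlow T h (zero  ∷ u) (zero  ∷ v) = refl
sumOver-liftFlow T h (zero  ∷ u) (suc _ ∷ v) = sumOver-zero T (λ _ → refl)
sumOver-liftFlow T h (suc _ ∷ u) w           = sumOver-zero T (λ _ → refl)

indicator : Bool → ℚ
indicator b = if b then 1ℚ else 0ℚ

required-unit : ∀ a b → required a b 1ℚ 1ℚ ≡ indicator a - indicator b
required-unit true  true  = refl
required-unit true  false = refl
required-unit false true  = refl
required-unit false false = refl

spread : ∀ {p m} → UniformMCF p m → Config p m → ArcFun p m
spread {p} {m} f s a b = sumOver (allConfigs p m) (λ t → f s t a b)

spread-solvesMSF : ∀ {p m} {f : UniformMCF p m} → IsUniformMCF p m f → ∀ s →
  SolvesMSF (_== s) (λ _ → true) (λ _ → ℕ→ℚ (numV p m)) (λ _ → 1ℚ) (spread f s)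
spread-solvesMSF {p} {m} {f} isMCF s = spread≥0 , netSpread
  where
  open ≡-Reasoning
  C : List (Config p m)
  C = allConfigs p m

  spread≥0 : ∀ a b → IsArc a b → 0ℚ ≤ spread f s a b
  spread≥0 a b arc = sumOver-nonNeg C (λ t → proj₁ (isMCF s t) a b arc)

  atSource : ∀ b →
    sumOver C (λ _ → indicator b) - 1ℚ ≡ required b true (ℕ→ℚ (numV p m)) 1ℚ
  atSource true  = cong (_- 1ℚ) (sym (ℕ→ℚ-length C))
  atSource false = trans (cong (_- 1ℚ) (sumOver-zero C (λ _ → refl))) (+-identityˡ (- 1ℚ))

  netSpread : ∀ u → net (spread f s) u ≡ required (u == s) true (ℕ→ℚ (numV p m)) 1ℚ
  netSpread u = begin
    net (spread f s) u
      ≡⟨ net-sumOver C (f s) u ⟩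
    sumOver C (λ t → net (f s t) u)
      ≡⟨ sumOver-cong C (λ t →
           trans (proj₂ (isMCF s t) u) (required-unit (u == s) (u == t))) ⟩
    sumOver C (λ t → indicator (u == s) - indicator (u == t))
      ≡⟨ sumOver-sub C (λ _ → indicator (u == s)) (λ t → indicator (u == t)) ⟩
    sumOver C (λ _ → indicator (u == s)) - sumOver C (λ t → indicator (u == t))
      ≡⟨ cong (λ y → sumOver C (λ _ → indicator (u == s)) - y)
              (sumOver-allConfigs-== u (λ _ → 1ℚ)) ⟩
    sumOver C (λ _ → indicator (u == s)) - 1ℚ
      ≡⟨ atSource (u == s) ⟩
    required (u == s) true (ℕ→ℚ (numV p m)) 1ℚ ∎

mcfLoad-nonNeg : ∀ {p n} {f : UniformMCF p n} → IsUniformMCF p n f →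
  ∀ u v → IsArc u v → 0ℚ ≤ mcfLoad p n f u v
mcfLoad-nonNeg {p} {n} isMCF u v arc = sumOver-nonNeg (allConfigs p n) (λ s →
  sumOver-nonNeg (allConfigs p n) (λ t → proj₁ (isMCF s t) u v arc))

congestion-nonNeg : ∀ {p n} {g : ArcFun p n} {ρ : ℚ} →
  (∀ u v → IsArc u v → 0ℚ ≤ g u v) → CongestionIs p n g ρ → 0ℚ ≤ ρ
congestion-nonNeg {p} {n} g≥0 (_ , u , v , arc , attained) =
  subst (0ℚ ≤_) attained
    (*-nonNeg (nonNegative⁻¹ (inv (numV p n)) {{inv-nonNeg (numV p n)}}) (g≥0 u v arc))

congestionAtMost-resp : ∀ {p n} {g h : ArcFun p n} {c d : ℚ} →
  (∀ u v → g u v ≡ h u v) → c ≡ d → CongestionAtMost p n g c → CongestionAtMost p n h d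
congestionAtMost-resp {p} {n} g≗h refl bound u v arc =
  subst (λ y → inv (numV p n) * y ≤ _) (g≗h u v) (bound u v arc)

inv-rescale : ∀ N .{{_ : NonZero N}} M {ρ x : ℚ} →
  inv N * x ≤ ρ → inv M * x ≤ ρ * (ℕ→ℚ N * inv M)
inv-rescale N M {ρ} {x} bound = begin
  inv M * x
    ≡⟨ sym cancel ⟩
  (ℕ→ℚ N * inv M) * (inv N * x)
    ≤⟨ *-monoˡ-≤-nonNeg (ℕ→ℚ N * inv M) {{ℕ→ℚ*inv-nonNeg N M}} bound ⟩
  (ℕ→ℚ N * inv M) * ρ
    ≡⟨ *-comm _ ρ ⟩
  ρ * (ℕ→ℚ N * inv M) ∎
  where
  open ≤-Reasoning
  cancel : (ℕ→ℚ N * inv M) * (inv N * x) ≡ inv M * x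
  cancel = trans (*-interchange (ℕ→ℚ N) (inv M) (inv N) x)
                 (trans (cong (_* (inv M * x)) (ℕ→ℚ*inv N)) (*-identityˡ (inv M * x)))

liftFlow-congestion : ∀ {q m} {L : ArcFun (suc q) m} {ρ : ℚ} → 0ℚ ≤ ρ →
  CongestionAtMost (suc q) m L ρ →
  CongestionAtMost (suc q) (suc m) (liftFlow L)
    (ρ * (ℕ→ℚ (numV (suc q) m) * inv (numV (suc q) (suc m))))
liftFlow-congestion {q} {m} {L} {ρ} ρ≥0 bound = lifted
  where
  N M : ℕ
  N = numV (suc q) m
  M = numV (suc q) (suc m)

  vanishing : inv M * 0ℚ ≤ ρ * (ℕ→ℚ N * inv M)
  vanishing = subst (_≤ ρ * (ℕ→ℚ N * inv M)) (sym (*-zeroʳ (inv M)))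
    (*-nonNeg ρ≥0 (nonNegative⁻¹ (ℕ→ℚ N * inv M) {{ℕ→ℚ*inv-nonNeg N M}}))

  lifted : CongestionAtMost (suc q) (suc m) (liftFlow L) (ρ * (ℕ→ℚ N * inv M))
  lifted (zero  ∷ u) (zero  ∷ v) arc =
    inv-rescale N {{numV-nonZero q m}} M (bound u v (IsArc-∷ zero u v arc))
  lifted (zero  ∷ u) (suc _ ∷ v) _ = vanishing
  lifted (suc _ ∷ u) w           _ = vanishing

lemma8 : (p n : ℕ) → 3 ℕ.≤ p → 2 ℕ.≤ n → (ρ : ℚ) →
    HasUniformMCFWithCongestion p (n ℕ.∸ 1) ρ →
    Σ (Config p n → ArcFun p n) (λ fshuf →
      (∀ s → inH1 s ≡ true →
        SolvesMSF (λ u → u == s) inH1 (λ _ → ℕ→ℚ (length (VH2 p n))) (λ _ → 1ℚ) (fshuf s))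
      × CongestionAtMost p n (λ u v → sumOver (VH1 p n) (λ s → fshuf s u v))
          (ρ * (ℕ→ℚ (length (VH1 p n)) * inv (numV p n))))
lemma8 p@(suc (suc (suc _))) (suc m@(suc _)) (s≤s (s≤s (s≤s _))) (s≤s (s≤s _)) ρ
       (f , isMCF , congestion) = fshuf , solves , bounded
  where
  fshuf : Config p (suc m) → ArcFun p (suc m)
  fshuf (_ ∷ s) = liftFlow (spread f s)

  solves : ∀ s → inH1 s ≡ true →
    SolvesMSF (_== s) inH1 (λ _ → ℕ→ℚ (length (VH2 p (suc m)))) (λ _ → 1ℚ) (fshuf s)
  solves (zero ∷ s) _ =
    subst (λ σ → SolvesMSF (_== (zero ∷ s)) inH1 (λ _ → σ) (λ _ → 1ℚ) (fshuf (zero ∷ s)))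
          (sym (ℕ→ℚ-length-largestOn {p} {m} (suc zero)))
          (liftFlow-solvesMSF (spread-solvesMSF isMCF s))

  bounded : CongestionAtMost p (suc m) (λ u v → sumOver (VH1 p (suc m)) (λ s → fshuf s u v))
              (ρ * (ℕ→ℚ (length (VH1 p (suc m))) * inv (numV p (suc m))))
  bounded = congestionAtMost-resp
    (λ u v → sym (trans (sumOver-largestOn {p} {m} zero (λ s → fshuf s u v))
                        (sumOver-liftFlow (allConfigs p m) (spread f) u v)))
    (cong (λ c → ρ * (c * inv (numV p (suc m)))) (sym (ℕ→ℚ-length-largestOn {p} {m} zero)))
    (liftFlow-congestion (congestion-nonNeg (mcfLoad-nonNeg isMCF) congestion) (proj₁ congestion))
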